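{- Let $G$ be an $R$-thin graph with vertices $v_1,\dots,v_n$, and let $\mu(G)$ be its Mycielski graph with additional vertices $u_1,\dots,u_n,w$. If $f$ is an automorphism of $\mu(G)$ with $f(w)=w$, then $f$ maps $\{v_1,\dots,v_n\}$ onto itself and $\{u_1,\dots,u_n\}$ onto itself, and there is a permutation $\sigma$ of $\{1,\dots,n\}$ such that $v_i\mapsto v_{\sigma(i)}$ is an automorphism of $G$ and $f(v_i)=v_{\sigma(i)}$, $f(u_i)=u_{\sigma(i)}$ for all $i$; that is, the restriction of $f$ to each of the sets $\{u_1,\dots,u_n\}$ and $\{v_1,\dots,v_n\}$ is (isomorphic to) the same automorphism of $G$.
   Context: Graphs are finite, simple and undirected. A graph is $R$-thin if no two distinct vertices have the same open neighborhood. For a graph $G$ with vertices $v_1,\dots,v_n$, the Mycielski graph $\mu(G)$ has vertex set $\{v_1,\dots,v_n,u_1,\dots,u_n,w\}$ and edge set consisting of the edges of $G$ on $v_1,\dots,v_n$, the edges $wu_i$ for all $i$, and for every edge $v_iv_j$ of $G$ the two edges $u_iv_j$ and $v_iu_j$. -}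

module Defs where

open import Data.Nat using (ℕ)
open import Data.Fin using (Fin)
open import Data.Empty using (⊥)
open import Data.Unit using (⊤)
open import Data.Product using (Σ; _×_; ∃)
open import Relation.Nullary using (¬_)
open import Relation.Binary.PropositionalEquality using (_≡_)
open import Function.Bundles using (_↔_; Inverse; _⇔_)

record Graph (V : Set) : Set₁ where
  field
    Adj    : V → V → Set
    sym    : ∀ {x y} → Adj x y → Adj y x
    irrefl : ∀ {x} → ¬ Adj x x
open Graph public

RThin : ∀ {V : Set} → Graph V → Set
RThin {V} G = ∀ (x y : V) → (∀ z → Adj G x z ⇔ Adj G y z) → x ≡ y

IsAutomorphism : ∀ {V : Set} → Graph V → (V ↔ V) → Set
IsAutomorphism {V} G f = ∀ (x y : V) → Adj G x y ⇔ Adj G (Inverse.to f x) (Inverse.to f y)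

data MVert (n : ℕ) : Set where
  v : Fin n → MVert n
  u : Fin n → MVert n
  w : MVert n

MAdj : ∀ {n} → Graph (Fin n) → MVert n → MVert n → Set
MAdj G (v i) (v j) = Adj G i j
MAdj G (v i) (u j) = Adj G i j
MAdj G (v i) w     = ⊥
MAdj G (u i) (v j) = Adj G i j
MAdj G (u i) (u j) = ⊥
MAdj G (u i) w     = ⊤
MAdj G w     (v j) = ⊥
MAdj G w     (u j) = ⊤
MAdj G w     w     = ⊥

mycielski : ∀ {n} → Graph (Fin n) → Graph (MVert n)
mycielski G = record { Adj = MAdj G ; sym = λ {x} {y} → s {x} {y} ; irrefl = λ {x} → ir {x} }
  where
  s : ∀ {x y} → MAdj G x y → MAdj G y x
  s {v i} {v j} a = sym G a
  s {v i} {u j} a = sym G a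
  s {u i} {v j} a = sym G a
  s {u i} {w} a = a
  s {w} {u j} a = a
  ir : ∀ {x} → ¬ MAdj G x x
  ir {v i} a = irrefl G a

module Submission where

-- An automorphism f of μ(G) fixing the apex w preserves
-- the neighbourhood of w, which is exactly the set of shadows u_i; hence f maps
-- shadows to shadows and, since it is injective and fixes w, originals v_i to
-- originals.  Applying the same reasoning to f⁻¹ (again an automorphism fixing
-- w) shows that both maps are onto, so f|v induces a permutation σ of Fin n,
-- which is an automorphism of G because the v_i span a copy of G in μ(G).
-- Let τ be the map induced by f|u.  The shadow u_i has exactly the neighbours
-- v_k of v_i among the originals, so σ(i) and τ(i) have the same neighbourhood
-- in G; R-thinness forces σ(i) = τ(i).

open import Defs hiding (sym)
open import Data.Nat using (ℕ)
open import Data.Fin using (Fin)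
open import Data.Product using (Σ; _×_; ∃-syntax; _,_; proj₁; proj₂)
open import Data.Empty using (⊥-elim)
open import Relation.Binary.PropositionalEquality
  using (_≡_; refl; sym; trans; cong; module ≡-Reasoning)
open import Function.Bundles using (_↔_; Inverse; _⇔_; mk↔ₛ′; Equivalence)
open import Function.Properties.Inverse using (↔-sym)
open import Function.Properties.Equivalence using ()
  renaming (sym to ⇔-sym; trans to ⇔-trans)

module _ {V : Set} (H : Graph V) (f : V ↔ V) (aut : IsAutomorphism H f) where

  private
    F : V → V
    F = Inverse.to f

  adjacency-along : ∀ {x y x' y'} → F x ≡ x' → F y ≡ y' → Adj H x y ⇔ Adj H x' y'
  adjacency-along {x} {y} refl refl = aut x y

  inverse-automorphism : IsAutomorphism H (↔-sym f)
  inverse-automorphism x y =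
    ⇔-sym (adjacency-along (Inverse.strictlyInverseˡ f x) (Inverse.strictlyInverseˡ f y))

to-injective : ∀ {V : Set} (f : V ↔ V) {x y} → Inverse.to f x ≡ Inverse.to f y → x ≡ y
to-injective f {x} {y} p = begin
  x                               ≡⟨ sym (Inverse.strictlyInverseʳ f x) ⟩
  Inverse.from f (Inverse.to f x) ≡⟨ cong (Inverse.from f) p ⟩
  Inverse.from f (Inverse.to f y) ≡⟨ Inverse.strictlyInverseʳ f y ⟩
  y                               ∎
  where open ≡-Reasoning

inverse-fixes : ∀ {V : Set} (f : V ↔ V) {x} → Inverse.to f x ≡ x → Inverse.from f x ≡ x
inverse-fixes f {x} fx = trans (cong (Inverse.from f) (sym fx)) (Inverse.strictlyInverseʳ f x)

onto-via-inverse : ∀ {I V : Set} (f : V ↔ V) {c : I → V} →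
  (∀ j → ∃[ i ] Inverse.from f (c j) ≡ c i) → ∀ j → ∃[ i ] Inverse.to f (c i) ≡ c j
onto-via-inverse f {c} back j with back j
... | i , eq = i , trans (cong (Inverse.to f) (sym eq)) (Inverse.strictlyInverseˡ f (c j))

v-injective : ∀ {n} {i j : Fin n} → v i ≡ v j → i ≡ j
v-injective refl = refl

module _ {n : ℕ} (G : Graph (Fin n)) where

  private
    μG : Graph (MVert n)
    μG = mycielski G

  module _ (f : MVert n ↔ MVert n) (aut : IsAutomorphism μG f)
           (fw : Inverse.to f w ≡ w) where

    private
      F : MVert n → MVert n
      F = Inverse.to f

    -- An original is not adjacent to w, so neither is its image; its image
    -- is not w itself since f is injective and fixes w.
    originals-to-originals : ∀ i → ∃[ j ] F (v i) ≡ v j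
    originals-to-originals i with F (v i) in eq
    ... | v j = j , refl
    ... | u j = ⊥-elim (Equivalence.from (adjacency-along μG f aut eq fw) _)
    ... | w with to-injective f {v i} {w} (trans eq (sym fw))
    ...   | ()

    -- A shadow is adjacent to w, so its image is a neighbour of w: a shadow.
    shadows-to-shadows : ∀ i → ∃[ j ] F (u i) ≡ u j
    shadows-to-shadows i with F (u i) in eq
    ... | u j = j , refl
    ... | v j = ⊥-elim (Equivalence.to (adjacency-along μG f aut eq fw) _)
    ... | w with to-injective f {u i} {w} (trans eq (sym fw))
    ...   | ()

  -- Surjectivity onto each class: apply the lemmas above to f⁻¹.
  module _ (f : MVert n ↔ MVert n) (aut : IsAutomorphism μG f)
           (fw : Inverse.to f w ≡ w) where

    private
      f⁻¹-aut : IsAutomorphism μG (↔-sym f)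
      f⁻¹-aut = inverse-automorphism μG f aut

    onto-originals : ∀ j → ∃[ i ] Inverse.to f (v i) ≡ v j
    onto-originals = onto-via-inverse f
      (originals-to-originals (↔-sym f) f⁻¹-aut (inverse-fixes f fw))

    onto-shadows : ∀ j → ∃[ i ] Inverse.to f (u i) ≡ u j
    onto-shadows = onto-via-inverse f
      (shadows-to-shadows (↔-sym f) f⁻¹-aut (inverse-fixes f fw))

  module Induced (f : MVert n ↔ MVert n) (aut : IsAutomorphism μG f)
                 (fw : Inverse.to f w ≡ w) where

    private
      F : MVert n → MVert n
      F = Inverse.to f

    σ-to : Fin n → Fin n
    σ-to i = proj₁ (originals-to-originals f aut fw i)

    σ-to-spec : ∀ i → F (v i) ≡ v (σ-to i)
    σ-to-spec i = proj₂ (originals-to-originals f aut fw i)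

    σ-from : Fin n → Fin n
    σ-from j = proj₁ (onto-originals f aut fw j)

    σ-from-spec : ∀ j → F (v (σ-from j)) ≡ v j
    σ-from-spec j = proj₂ (onto-originals f aut fw j)

    τ : Fin n → Fin n
    τ i = proj₁ (shadows-to-shadows f aut fw i)

    τ-spec : ∀ i → F (u i) ≡ u (τ i)
    τ-spec i = proj₂ (shadows-to-shadows f aut fw i)

    σ : Fin n ↔ Fin n
    σ = mk↔ₛ′ σ-to σ-from
      (λ j → v-injective (trans (sym (σ-to-spec (σ-from j))) (σ-from-spec j)))
      (λ i → v-injective (to-injective f (trans (σ-from-spec (σ-to i)) (sym (σ-to-spec i)))))

    -- The originals induce G inside μ(G), so σ is an automorphism of G.
    σ-automorphism : IsAutomorphism G σ
    σ-automorphism i k = adjacency-along μG f aut (σ-to-spec i) (σ-to-spec k)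

    -- Writing z = σ(k): Adj (σ i) z ⇔ Adj i k ⇔ [u_i ~ v_k] ⇔ Adj (τ i) z.
    same-neighbourhood : ∀ i z → Adj G (σ-to i) z ⇔ Adj G (τ i) z
    same-neighbourhood i z = ⇔-trans
      (⇔-sym (adjacency-along μG f aut (σ-to-spec i) (σ-from-spec z)))
      (adjacency-along μG f aut (τ-spec i) (σ-from-spec z))

    σ-agrees-on-shadows : RThin G → ∀ i → F (u i) ≡ u (σ-to i)
    σ-agrees-on-shadows thin i =
      trans (τ-spec i) (cong u (sym (thin (σ-to i) (τ i) (same-neighbourhood i))))

mainTheorem11 : (n : ℕ) (G : Graph (Fin n)) → RThin G →
    (f : MVert n ↔ MVert n) → IsAutomorphism (mycielski G) f →
    Inverse.to f w ≡ w →
    ((∀ i → ∃[ j ] Inverse.to f (v i) ≡ v j) × (∀ j → ∃[ i ] Inverse.to f (v i) ≡ v j)) ×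
    ((∀ i → ∃[ j ] Inverse.to f (u i) ≡ u j) × (∀ j → ∃[ i ] Inverse.to f (u i) ≡ u j)) ×
    (Σ (Fin n ↔ Fin n) λ σ → IsAutomorphism G σ ×
    (∀ i → (Inverse.to f (v i) ≡ v (Inverse.to σ i)) × (Inverse.to f (u i) ≡ u (Inverse.to σ i))))
mainTheorem11 n G thin f aut fw =
  (originals-to-originals G f aut fw , onto-originals G f aut fw) ,
  (shadows-to-shadows G f aut fw , onto-shadows G f aut fw) ,
  σ , σ-automorphism , λ i → σ-to-spec i , σ-agrees-on-shadows thin i
  where open Induced G f aut fw
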